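{- Let $G$ be a graph, let $\mathbf{a},\mathbf{b},\mathbf{c}\in V(G)^2$ be pairwise disjoint ordered pairs of vertices, and let $\ell_1,\ell_2\in\mathbb{N}$ be such that both $\ell_1$ and $\ell_1+\ell_2-2$ are divisible by four. Suppose that $G$ contains a $(2,\ell_1)$-pseudo-path connecting $\mathbf{a}$ to $\mathbf{b}$ and a $(2,\ell_2)$-pseudo-path connecting $\overline{\mathbf{c}}$ to $\mathbf{b}$, and that these two paths are internally vertex disjoint. Then the union of these two paths is a backbone-path connecting $\mathbf{a}$ to $\mathbf{c}$.
   Context: $V^2$ denotes the set of ordered pairs of distinct elements of $V$; for $\mathbf{w}=(x,y)$, $\overline{\mathbf{w}}=(y,x)$. An embedding of $H$ into $G$ is an injective map $V(H)\to V(G)$ sending edges to edges. The $(2,\ell)$-pseudo-path $S^2_\ell$ is the graph on $\{u_1,\dots,u_\ell\}$ with edges $\{u_{i-1},u_i\}$ for $2\le i\le\ell$, $\{u_{i-2},u_i\}$ for odd $i\in\{3,\dots,\ell\}$, and $\{u_{i-3},u_i\}$ for even $i\in\{4,\dots,\ell\}$. A $(2,\ell)$-pseudo-path connecting $\mathbf{x}$ to $\mathbf{y}$ is an embedding $g$ of $S^2_\ell$ into $G$ with $\mathbf{x}=(g(u_1),g(u_2))$ and $\mathbf{y}=(g(u_{\ell-1}),g(u_\ell))$. The 4-square-path on an ordered sequence of four vertices $(z_1,z_2,z_3,z_4)$ has edges $z_1z_2,z_2z_3,z_3z_4,z_1z_3,z_2z_4$. The $k$-backbone-path $B_k$ has vertex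 set $\{w_{i,j}: i\in[k], j\in[4]\}$; with $\mathbf{w}_i^a=(w_{i,1},w_{i,2})$, $\mathbf{w}_i^b=(w_{i,3},w_{i,4})$, its edge set is the union of: the edges $\{w_{1,1},w_{1,2}\}$ and $\{w_{1,3},w_{1,4}\}$; the 4-square-path on $(\mathbf{w}_i^a,\mathbf{w}_i^b)$ for every $2\le i\le k$; the 4-square-path on $(\mathbf{w}_1^a,\overline{\mathbf{w}}_2^a)$; the 4-square-path on $(\overline{\mathbf{w}}_i^b,\overline{\mathbf{w}}_{i+2}^a)$ for every $1\le i\le k-2$; and the 4-square-path on $(\overline{\mathbf{w}}_{k-1}^b,\mathbf{w}_k^b)$. A backbone-path connecting $\mathbf{a}$ to $\mathbf{c}$ is an embedding $g$ of $B_k$ into $G$ for some $k$, with $\mathbf{a}=(g(w_{1,2}),g(w_{1,1}))$ and $\mathbf{c}=(g(w_{1,4}),g(w_{1,3}))$. The two pseudo-paths are internally vertex disjoint if their only common vertices are the two vertices of $\mathbf{b}$. -}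

module Defs where

open import Data.Nat using (ℕ; zero; suc; _+_; _∸_; _≤_; _%_)
open import Data.Nat.Divisibility using (_∣_)
open import Data.Fin using (Fin; toℕ)
open import Data.Product using (Σ; ∃; _×_; _,_; proj₁; proj₂)
open import Data.Sum using (_⊎_)
open import Relation.Nullary using (¬_)
open import Relation.Binary.PropositionalEquality using (_≡_; _≢_)

record Graph : Set₁ where
  field
    V       : Set
    Adj     : V → V → Set
    symAdj  : ∀ {x y} → Adj x y → Adj y x
    irrAdj  : ∀ {x} → ¬ Adj x x
open Graph public

Pair : Set → Set
Pair V = V × V

InV² : {V : Set} → Pair V → Set
InV² (x , y) = x ≢ y

rev : {V : Set} → Pair V → Pair V
rev (x , y) = (y , x)

DisjointPairs : {V : Set} → Pair V → Pair V → Set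
DisjointPairs (x₁ , x₂) (y₁ , y₂) =
  (x₁ ≢ y₁) × (x₁ ≢ y₂) × (x₂ ≢ y₁) × (x₂ ≢ y₂)

record Embedding (HV : Set) (HE : HV → HV → Set) (G : Graph) : Set where
  field
    map      : HV → V G
    inj      : ∀ {p q} → map p ≡ map q → p ≡ q
    edges    : ∀ {p q} → HE p q → Adj G (map p) (map q)
open Embedding public

InImage : {HV V : Set} → (HV → V) → V → Set
InImage {HV} f v = Σ HV λ p → f p ≡ v

EdgeImage : {HV V : Set} → (HE : HV → HV → Set) → (HV → V) → V → V → Set
EdgeImage {HV} HE f v w =
  Σ HV λ p → Σ HV λ q → HE p q × ((f p ≡ v × f q ≡ w) ⊎ (f p ≡ w × f q ≡ v))

-- (2,ℓ)-pseudo-path S²_ℓ.  Vertex u_i (1 ≤ i ≤ ℓ) is the element p : Fin ℓ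
-- with label suc (toℕ p) = i.  Edges are stated on 1-based labels.

data SLabEdge (ℓ : ℕ) : ℕ → ℕ → Set where
  step : ∀ {i} → 2 ≤ i → i ≤ ℓ → SLabEdge ℓ (i ∸ 1) i
  oddE : ∀ {i} → 3 ≤ i → i ≤ ℓ → i % 2 ≡ 1 → SLabEdge ℓ (i ∸ 2) i
  evnE : ∀ {i} → 4 ≤ i → i ≤ ℓ → i % 2 ≡ 0 → SLabEdge ℓ (i ∸ 3) i

lab : ∀ {n} → Fin n → ℕ
lab p = suc (toℕ p)

SEdge : (ℓ : ℕ) → Fin ℓ → Fin ℓ → Set
SEdge ℓ p q = SLabEdge ℓ (lab p) (lab q)

record PseudoPath (G : Graph) (ℓ : ℕ) (x y : Pair (V G)) : Set where
  field
    emb    : Embedding (Fin ℓ) (SEdge ℓ) G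
    two≤ℓ  : 2 ≤ ℓ
    src₁   : ∀ p → lab p ≡ 1 → map emb p ≡ proj₁ x
    src₂   : ∀ p → lab p ≡ 2 → map emb p ≡ proj₂ x
    tgt₁   : ∀ p → lab p ≡ ℓ ∸ 1 → map emb p ≡ proj₁ y
    tgt₂   : ∀ p → lab p ≡ ℓ → map emb p ≡ proj₂ y
open PseudoPath public

data Sq {A : Set} (z₁ z₂ z₃ z₄ : A) : A → A → Set where
  s12 : Sq z₁ z₂ z₃ z₄ z₁ z₂
  s23 : Sq z₁ z₂ z₃ z₄ z₂ z₃
  s34 : Sq z₁ z₂ z₃ z₄ z₃ z₄
  s13 : Sq z₁ z₂ z₃ z₄ z₁ z₃
  s24 : Sq z₁ z₂ z₃ z₄ z₂ z₄

-- k-backbone-path B_k.  Vertex w_{i,j} is (p , r) : Fin k × Fin 4 with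
-- label (suc (toℕ p) , suc (toℕ r)) = (i , j).  Edges on 1-based labels.

Lab : Set
Lab = ℕ × ℕ

data BLabEdge (k : ℕ) : Lab → Lab → Set where
  firstA : BLabEdge k (1 , 1) (1 , 2)
  firstB : BLabEdge k (1 , 3) (1 , 4)
  -- 4-square-path on (w_i^a , w_i^b), 2 ≤ i ≤ k
  rung   : ∀ {i x y} → 2 ≤ i → i ≤ k →
           Sq (i , 1) (i , 2) (i , 3) (i , 4) x y → BLabEdge k x y
  -- 4-square-path on (w_1^a , reversed w_2^a)
  start  : ∀ {x y} → 2 ≤ k →
           Sq (1 , 1) (1 , 2) (2 , 2) (2 , 1) x y → BLabEdge k x y
  -- 4-square-path on (reversed w_i^b , reversed w_{i+2}^a), 1 ≤ i ≤ k-2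
  link   : ∀ {i x y} → 1 ≤ i → i ≤ k ∸ 2 →
           Sq (i , 4) (i , 3) (i + 2 , 2) (i + 2 , 1) x y → BLabEdge k x y
  -- 4-square-path on (reversed w_{k-1}^b , w_k^b)
  finish : ∀ {x y} → 2 ≤ k →
           Sq (k ∸ 1 , 4) (k ∸ 1 , 3) (k , 3) (k , 4) x y → BLabEdge k x y

BLab : ∀ {k} → Fin k × Fin 4 → Lab
BLab (p , r) = (lab p , lab r)

BEdge : (k : ℕ) → Fin k × Fin 4 → Fin k × Fin 4 → Set
BEdge k v w = BLabEdge k (BLab v) (BLab w)

record BackbonePath (G : Graph) (k : ℕ) (a c : Pair (V G)) : Set where
  field
    emb   : Embedding (Fin k × Fin 4) (BEdge k) G
    one≤k : 1 ≤ k
    a₁    : ∀ v → BLab v ≡ (1 , 2) → map emb v ≡ proj₁ a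
    a₂    : ∀ v → BLab v ≡ (1 , 1) → map emb v ≡ proj₂ a
    c₁    : ∀ v → BLab v ≡ (1 , 4) → map emb v ≡ proj₁ c
    c₂    : ∀ v → BLab v ≡ (1 , 3) → map emb v ≡ proj₂ c
open BackbonePath public

InternallyDisjoint : ∀ {G ℓ₁ ℓ₂ x y z} → (b : Pair (V G)) →
  PseudoPath G ℓ₁ x y → PseudoPath G ℓ₂ z b → Set
InternallyDisjoint {ℓ₁ = ℓ₁} {ℓ₂} b P Q =
  ∀ (p : Fin ℓ₁) (q : Fin ℓ₂) → map (emb P) p ≡ map (emb Q) q →
    (map (emb P) p ≡ proj₁ b) ⊎ (map (emb P) p ≡ proj₂ b)

UnionIs : ∀ {G ℓ₁ ℓ₂ k x y z w a c} →
  PseudoPath G ℓ₁ x y → PseudoPath G ℓ₂ z w → BackbonePath G k a c → Set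
UnionIs {G} {ℓ₁} {ℓ₂} {k} P Q B =
  (∀ v → (InImage (map (emb B)) v →
            InImage (map (emb P)) v ⊎ InImage (map (emb Q)) v)
       × (InImage (map (emb P)) v ⊎ InImage (map (emb Q)) v →
            InImage (map (emb B)) v))
  ×
  (∀ v w → (EdgeImage (BEdge k) (map (emb B)) v w →
              EdgeImage (SEdge ℓ₁) (map (emb P)) v w
              ⊎ EdgeImage (SEdge ℓ₂) (map (emb Q)) v w)
         × (EdgeImage (SEdge ℓ₁) (map (emb P)) v w
              ⊎ EdgeImage (SEdge ℓ₂) (map (emb Q)) v w →
            EdgeImage (BEdge k) (map (emb B)) v w))

-- Put u_{2T+1} and u_{2T+2} of S²_{2m+2} into block T of a ladder: the pseudo-path is then
-- exactly the union of the 4-square-paths (u_{2T+2}, u_{2T+1}, u_{2T+3}, u_{2T+4}) joining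
-- consecutive blocks. Gluing the ladder of the first path to the reversed ladder of the second
-- along their common end block b gives a ladder with m + n + 1 blocks, still injective because
-- the paths meet only in b, and the divisibility conditions make m + n + 1 = 2k. The
-- backbone-path B_k is this same ladder on 2k blocks: it climbs through the pairs w_i^a, w_i^b
-- of even index and comes back down through those of odd index, each of its squares covers two
-- consecutive blocks and every two consecutive blocks are covered by one of its squares. All
-- these identifications are isomorphisms of graphs, so vertex and edge sets are preserved.

module Submission where

open import Defs
open import Data.Bool using (Bool; true; false; if_then_else_)
open import Data.Empty using (⊥-elim)
open import Data.Fin using (Fin; toℕ; fromℕ<)
open import Data.Fin.Patterns using (0F; 1F; 2F; 3F)
open import Data.Fin.Properties using (toℕ-injective; toℕ<n; toℕ-fromℕ<)
open import Data.Nat using (ℕ; zero; suc; _+_; _∸_; _*_; _≤_; _<_; z≤n; s≤s; s≤s⁻¹; _≤?_)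
open import Data.Nat.DivMod using ([m+kn]%n≡m%n)
open import Data.Nat.Divisibility using (_∣_; divides; ∣m+n∣m⇒∣n)
open import Data.Nat.Properties
open import Data.Nat.Tactic.RingSolver using (solve-∀)
open import Data.Product using (Σ; _×_; _,_; proj₁; proj₂)
open import Data.Sum using (_⊎_; inj₁; inj₂; [_,_]′)
import Data.Sum
open import Data.Sum.Function.Propositional using (_⊎-⇔_)
open import Function using (_∘_; _⇔_; mk⇔; Equivalence)
open import Function.Properties.Equivalence using () renaming (trans to ⇔-trans)
open import Relation.Binary using (tri<; tri≈; tri>)
open import Relation.Binary.PropositionalEquality
open import Relation.Nullary using (Dec; yes; no)

-- Images along isomorphisms

Linked : {A : Set} → (A → A → Set) → A → A → Set
Linked E x y = E x y ⊎ E y x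

image-elim : ∀ {HV W : Set} {f : HV → W} (R : W → Set) → (∀ p → R (f p)) →
  ∀ {v} → InImage f v → R v
image-elim R along (p , refl) = along p

module _ {HV W : Set} {HE : HV → HV → Set} {f : HV → W} where

  edgeImage-swap : ∀ {v w} → EdgeImage HE f v w → EdgeImage HE f w v
  edgeImage-swap (p , q , e , inj₁ ends) = p , q , e , inj₂ ends
  edgeImage-swap (p , q , e , inj₂ ends) = p , q , e , inj₁ ends

  edgeImage-linked : ∀ {p q} → Linked HE p q → EdgeImage HE f (f p) (f q)
  edgeImage-linked {p} {q} (inj₁ e) = p , q , e , inj₁ (refl , refl)
  edgeImage-linked {p} {q} (inj₂ e) = q , p , e , inj₂ (refl , refl)

  edgeImage-elim : (R : W → W → Set) → (∀ {v w} → R v w → R w v) →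
    (∀ {p q} → HE p q → R (f p) (f q)) → ∀ {v w} → EdgeImage HE f v w → R v w
  edgeImage-elim R sym-R along (p , q , e , inj₁ (refl , refl)) = along e
  edgeImage-elim R sym-R along (p , q , e , inj₂ (refl , refl)) = sym-R (along e)

record Isomorphism {HV HV′ : Set} (HE : HV → HV → Set) (HE′ : HV′ → HV′ → Set) : Set where
  field
    to         : HV → HV′
    injective  : ∀ {p q} → to p ≡ to q → p ≡ q
    surjective : ∀ q → Σ HV λ p → to p ≡ q
    edge       : ∀ {p q} → HE p q → Linked HE′ (to p) (to q)
    edge⁻¹     : ∀ {p q} → HE′ (to p) (to q) → Linked HE p q

module _ {HV HV′ : Set} {HE : HV → HV → Set} {HE′ : HV′ → HV′ → Set}
         (I : Isomorphism HE HE′) where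
  open Isomorphism I

  precompose : ∀ {G} → Embedding HV′ HE′ G → Embedding HV HE G
  precompose {G} e = record
    { map   = map e ∘ to
    ; inj   = injective ∘ inj e
    ; edges = [ edges e , symAdj G ∘ edges e ]′ ∘ edge
    }

  image-precompose : ∀ {W} (f : HV′ → W) v → InImage (f ∘ to) v ⇔ InImage f v
  image-precompose f v = mk⇔
    (image-elim (InImage f) λ p → to p , refl)
    (image-elim (InImage (f ∘ to)) λ q → let (p , p↦q) = surjective q in p , cong f p↦q)

  edgeImage-precompose : ∀ {W} (f : HV′ → W) v w →
    EdgeImage HE (f ∘ to) v w ⇔ EdgeImage HE′ f v w
  edgeImage-precompose f v w = mk⇔
    (edgeImage-elim (EdgeImage HE′ f) edgeImage-swap (edgeImage-linked ∘ edge))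
    (edgeImage-elim (EdgeImage HE (f ∘ to)) edgeImage-swap reflect)
    where
    reflect : ∀ {q q′} → HE′ q q′ → EdgeImage HE (f ∘ to) (f q) (f q′)
    reflect {q} {q′} e with surjective q | surjective q′
    ... | p , refl | p′ , refl = edgeImage-linked (edge⁻¹ e)

involution-isomorphism : ∀ {HV} {HE : HV → HV → Set} (φ : HV → HV) →
  (∀ p → φ (φ p) ≡ p) → (∀ {p q} → HE p q → Linked HE (φ p) (φ q)) → Isomorphism HE HE
involution-isomorphism {HE = HE} φ φφ≗id φ-edge = record
  { to         = φ
  ; injective  = λ {p} {q} φp≡φq → trans (sym (φφ≗id p)) (trans (cong φ φp≡φq) (φφ≗id q))
  ; surjective = λ q → φ q , φφ≗id q
  ; edge       = φ-edge
  ; edge⁻¹     = λ {p} {q} e → subst₂ (Linked HE) (φφ≗id p) (φφ≗id q) (φ-edge e)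
  }

-- The ladder

Slot : Set
Slot = ℕ × Bool

block : Slot → ℕ
block = proj₁

side : Slot → Bool
side = proj₂

data LadderEdge : Slot → Slot → Set where
  inner : ∀ T → LadderEdge (T , false) (T , true)
  lower : ∀ T s → LadderEdge (T , false) (suc T , s)
  upper : ∀ T → LadderEdge (T , true) (suc T , false)

ladderEdge-block≤ : ∀ {u v} → LadderEdge u v → block u ≤ block v
ladderEdge-block≤ (inner T)   = ≤-refl
ladderEdge-block≤ (lower T s) = n≤1+n T
ladderEdge-block≤ (upper T)   = n≤1+n T

ladderEdge-block≤suc : ∀ {u v} → LadderEdge u v → block v ≤ suc (block u)
ladderEdge-block≤suc (inner T)   = n≤1+n T
ladderEdge-block≤suc (lower T s) = ≤-refl
ladderEdge-block≤suc (upper T)   = ≤-refl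

record Bounded (N : ℕ) : Set where
  constructor _⊣_
  field
    slot  : Slot
    bound : block slot ≤ N
open Bounded

bounded-≡ : ∀ {N} {p q : Bounded N} → slot p ≡ slot q → p ≡ q
bounded-≡ {p = u ⊣ u≤N} {.u ⊣ u≤N′} refl = cong (u ⊣_) (≤-irrelevant u≤N u≤N′)

LadderAdj : ∀ {N} → Bounded N → Bounded N → Set
LadderAdj p q = LadderEdge (slot p) (slot q)

Ladder : Graph → ℕ → Set
Ladder G N = Embedding (Bounded N) LadderAdj G

map-slot : ∀ {G N} (L : Ladder G N) {p q} → slot p ≡ slot q → map L p ≡ map L q
map-slot L = cong (map L) ∘ bounded-≡

position : Slot → ℕ
position (T , false) = T * 2
position (T , true)  = suc (T * 2)

next : Slot → Slot
next (T , false) = T , true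
next (T , true)  = suc T , false

slotAt : ℕ → Slot
slotAt zero    = 0 , false
slotAt (suc n) = next (slotAt n)

slotAt-double : ∀ T → slotAt (T * 2) ≡ (T , false)
slotAt-double zero    = refl
slotAt-double (suc T) = cong (next ∘ next) (slotAt-double T)

slotAt-position : ∀ u → slotAt (position u) ≡ u
slotAt-position (T , false) = slotAt-double T
slotAt-position (T , true)  = cong next (slotAt-double T)

position-slotAt : ∀ n → position (slotAt n) ≡ n
position-slotAt zero = refl
position-slotAt (suc n) with slotAt n | position-slotAt n
... | T , false | refl = refl
... | T , true  | refl = refl

position-injective : ∀ {u v} → position u ≡ position v → u ≡ v
position-injective {u} {v} eq =
  trans (sym (slotAt-position u)) (trans (cong slotAt eq) (slotAt-position v))

position-< : ∀ {m} u → block u ≤ m → position u < suc m * 2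
position-< (T , false) T≤m = s≤s (≤-trans (*-monoˡ-≤ 2 T≤m) (n≤1+n _))
position-< (T , true)  T≤m = s≤s (s≤s (*-monoˡ-≤ 2 T≤m))

block-≤ : ∀ {m} u → position u < suc m * 2 → block u ≤ m
block-≤ {m} u lt = s≤s⁻¹ (*-cancelʳ-< 2 (block u) (suc m) (≤-<-trans (double≤position u) lt))
  where
  double≤position : ∀ u → block u * 2 ≤ position u
  double≤position (T , false) = ≤-refl
  double≤position (T , true)  = n≤1+n _

data Halving : ℕ → Set where
  twice   : ∀ t → Halving (t * 2)
  twice+1 : ∀ t → Halving (suc (t * 2))

halve : ∀ n → Halving n
halve zero = twice 0
halve (suc n) with halve n
... | twice t   = twice+1 t
... | twice+1 t = twice (suc t)

pseudoPathEdge⇒ladderEdge : ∀ {ℓ a b} → SLabEdge ℓ a b → LadderEdge (slotAt (a ∸ 1)) (slotAt (b ∸ 1))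
pseudoPathEdge⇒ladderEdge (step {suc (suc j)} (s≤s (s≤s z≤n)) _) = next-edge (slotAt j)
  where
  next-edge : ∀ u → LadderEdge u (next u)
  next-edge (T , false) = inner T
  next-edge (T , true)  = upper T
pseudoPathEdge⇒ladderEdge (oddE {suc (suc (suc j))} (s≤s (s≤s (s≤s z≤n))) _ odd) with halve j
... | twice t rewrite slotAt-double t = lower t false
... | twice+1 t with () ← trans (sym ([m+kn]%n≡m%n 4 t 2)) odd
pseudoPathEdge⇒ladderEdge (evnE {suc (suc (suc (suc j)))} (s≤s (s≤s (s≤s (s≤s z≤n)))) _ even) with halve j
... | twice t rewrite slotAt-double t = lower t true
... | twice+1 t with () ← trans (sym ([m+kn]%n≡m%n 5 t 2)) even

ladderEdge⇒pseudoPathEdge : ∀ {ℓ u v} → LadderEdge u v → position v < ℓ →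
  SLabEdge ℓ (suc (position u)) (suc (position v))
ladderEdge⇒pseudoPathEdge (inner T)       v<ℓ = step (s≤s (s≤s z≤n)) v<ℓ
ladderEdge⇒pseudoPathEdge (lower T false) v<ℓ = oddE (s≤s (s≤s (s≤s z≤n))) v<ℓ ([m+kn]%n≡m%n 3 T 2)
ladderEdge⇒pseudoPathEdge (lower T true)  v<ℓ =
  evnE (s≤s (s≤s (s≤s (s≤s z≤n)))) v<ℓ ([m+kn]%n≡m%n 4 T 2)
ladderEdge⇒pseudoPathEdge (upper T)       v<ℓ = step (s≤s (s≤s z≤n)) v<ℓ

module _ {m : ℕ} where

  pathVertex : Bounded m → Fin (suc m * 2)
  pathVertex p = fromℕ< (position-< (slot p) (bound p))

  toℕ-pathVertex : ∀ p → toℕ (pathVertex p) ≡ position (slot p)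
  toℕ-pathVertex p = toℕ-fromℕ< (position-< (slot p) (bound p))

  ladder≅pseudoPath : Isomorphism (LadderAdj {m}) (SEdge (suc m * 2))
  ladder≅pseudoPath = record
    { to         = pathVertex
    ; injective  = λ {p} {q} eq → bounded-≡ (position-injective
        (trans (sym (toℕ-pathVertex p)) (trans (cong toℕ eq) (toℕ-pathVertex q))))
    ; surjective = surjective
    ; edge       = λ {p} {q} e → inj₁ (subst₂ (λ a b → SLabEdge _ (suc a) (suc b))
        (sym (toℕ-pathVertex p)) (sym (toℕ-pathVertex q))
        (ladderEdge⇒pseudoPathEdge e (position-< (slot q) (bound q))))
    ; edge⁻¹     = λ {p} {q} e → inj₁ (subst₂ LadderEdge (slotAt-pathVertex p) (slotAt-pathVertex q)
        (pseudoPathEdge⇒ladderEdge e))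
    }
    where
    surjective : ∀ i → Σ (Bounded m) λ p → pathVertex p ≡ i
    surjective i = p , toℕ-injective (trans (toℕ-pathVertex p) (position-slotAt (toℕ i)))
      where
      p : Bounded m
      p = slotAt (toℕ i) ⊣ block-≤ (slotAt (toℕ i))
        (subst (_< suc m * 2) (sym (position-slotAt (toℕ i))) (toℕ<n i))

    slotAt-pathVertex : ∀ p → slotAt (toℕ (pathVertex p)) ≡ slot p
    slotAt-pathVertex p = trans (cong slotAt (toℕ-pathVertex p)) (slotAt-position (slot p))

module PathLadder {G : Graph} {m : ℕ} {x y : Pair (V G)} (P : PseudoPath G (suc m * 2) x y) where

  ladder : Ladder G m
  ladder = precompose (ladder≅pseudoPath {m}) (emb P)

  private
    lab-pathVertex : ∀ (p : Bounded m) → lab (pathVertex p) ≡ suc (position (slot p))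
    lab-pathVertex p = cong suc (toℕ-pathVertex p)

  start₁ : ∀ {b} → map ladder ((0 , false) ⊣ b) ≡ proj₁ x
  start₁ {b} = src₁ P _ (lab-pathVertex ((0 , false) ⊣ b))

  start₂ : ∀ {b} → map ladder ((0 , true) ⊣ b) ≡ proj₂ x
  start₂ {b} = src₂ P _ (lab-pathVertex ((0 , true) ⊣ b))

  end₁ : ∀ {b} → map ladder ((m , false) ⊣ b) ≡ proj₁ y
  end₁ {b} = tgt₁ P _ (lab-pathVertex ((m , false) ⊣ b))

  end₂ : ∀ {b} → map ladder ((m , true) ⊣ b) ≡ proj₂ y
  end₂ {b} = tgt₂ P _ (lab-pathVertex ((m , true) ⊣ b))

  end⁻¹ : ∀ p → map ladder p ≡ proj₁ y ⊎ map ladder p ≡ proj₂ y →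
    block (slot p) ≡ m
  end⁻¹ p (inj₁ p↦y₁) =
    cong (block ∘ slot) (inj ladder {p} {(m , false) ⊣ ≤-refl} (trans p↦y₁ (sym (end₁ {≤-refl}))))
  end⁻¹ p (inj₂ p↦y₂) =
    cong (block ∘ slot) (inj ladder {p} {(m , true) ⊣ ≤-refl} (trans p↦y₂ (sym (end₂ {≤-refl}))))

reflect : ℕ → Slot → Slot
reflect N u = N ∸ block u , side u

reflect-edge : ∀ {N u v} → LadderEdge u v → block v ≤ N →
  Linked LadderEdge (reflect N u) (reflect N v)
reflect-edge {N} (inner T) _ = inj₁ (inner (N ∸ T))
reflect-edge {N} (lower T false) T<N rewrite +-∸-assoc 1 T<N = inj₂ (lower (N ∸ suc T) false)
reflect-edge {N} (lower T true)  T<N rewrite +-∸-assoc 1 T<N = inj₂ (upper (N ∸ suc T))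
reflect-edge {N} (upper T)       T<N rewrite +-∸-assoc 1 T<N = inj₂ (lower (N ∸ suc T) true)

mirror : ∀ {N} → Bounded N → Bounded N
mirror {N} (u ⊣ _) = reflect N u ⊣ m∸n≤m N (block u)

mirror-involutive : ∀ {N} (p : Bounded N) → mirror (mirror p) ≡ p
mirror-involutive p = bounded-≡ (cong (_, side (slot p)) (m∸[m∸n]≡n (bound p)))

ladder≅mirror : ∀ {N} → Isomorphism (LadderAdj {N}) LadderAdj
ladder≅mirror = involution-isomorphism mirror mirror-involutive (λ {p} {q} e → reflect-edge e (bound q))

reverse : ∀ {G N} → Ladder G N → Ladder G N
reverse = precompose ladder≅mirror

-- Gluing two ladders along a common end block

shift : ℕ → Slot → Slot
shift m u = block u + m , side u

unshift : ℕ → Slot → Slot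
unshift m u = block u ∸ m , side u

shift-edge : ∀ {m u v} → LadderEdge u v → LadderEdge (shift m u) (shift m v)
shift-edge {m} (inner T)   = inner (T + m)
shift-edge {m} (lower T s) = lower (T + m) s
shift-edge {m} (upper T)   = upper (T + m)

unshift-edge : ∀ {m u v} → m ≤ block u → LadderEdge u v → LadderEdge (unshift m u) (unshift m v)
unshift-edge {m} _   (inner T)                              = inner (T ∸ m)
unshift-edge {m} m≤T (lower T s) rewrite +-∸-assoc 1 m≤T = lower (T ∸ m) s
unshift-edge {m} m≤T (upper T)   rewrite +-∸-assoc 1 m≤T = upper (T ∸ m)

shift-unshift : ∀ {m} u → m ≤ block u → shift m (unshift m u) ≡ u
shift-unshift u m≤T = cong (_, side u) (m∸n+n≡m m≤T)

module Glue {G : Graph} {m n : ℕ} (L₁ : Ladder G m) (L₂ : Ladder G n)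
  (junction : ∀ s → map L₁ ((m , s) ⊣ ≤-refl) ≡ map L₂ ((0 , s) ⊣ z≤n))
  (meet-at-junction : ∀ p q → map L₁ p ≡ map L₂ q → block (slot p) ≡ m) where

  left : Bounded m → Bounded (m + n)
  left (u ⊣ u≤m) = u ⊣ ≤-trans u≤m (m≤m+n m n)

  right : Bounded n → Bounded (m + n)
  right (u ⊣ u≤n) = shift m u ⊣ ≤-trans (+-monoˡ-≤ m u≤n) (≤-reflexive (+-comm n m))

  glued-map : Bounded (m + n) → V G
  glued-map ((T , s) ⊣ T≤m+n) with T ≤? m
  ... | yes T≤m = map L₁ ((T , s) ⊣ T≤m)
  ... | no  _   = map L₂ ((T ∸ m , s) ⊣ m≤n+o⇒m∸n≤o T m T≤m+n)

  glued-left : ∀ p → glued-map (left p) ≡ map L₁ p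
  glued-left p@((T , s) ⊣ _) with T ≤? m
  ... | yes _  = map-slot L₁ refl
  ... | no T≰m = ⊥-elim (T≰m (bound p))

  glued-right : ∀ q → glued-map (right q) ≡ map L₂ q
  glued-right ((T , s) ⊣ _) with T + m ≤? m
  ... | yes T+m≤m with refl ← n≤0⇒n≡0 (+-cancelʳ-≤ m T 0 T+m≤m) =
    trans (map-slot L₁ refl) (trans (junction s) (map-slot L₂ refl))
  ... | no  _     = map-slot L₂ (cong (_, s) (m+n∸n≡m T m))

  glued-cover : ∀ r → (Σ (Bounded m) λ p → left p ≡ r) ⊎ (Σ (Bounded n) λ q → right q ≡ r)
  glued-cover ((T , s) ⊣ T≤m+n) = cover (T ≤? m)
    where
    cover : Dec (T ≤ m) → (Σ (Bounded m) λ p → left p ≡ ((T , s) ⊣ T≤m+n))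
                        ⊎ (Σ (Bounded n) λ q → right q ≡ ((T , s) ⊣ T≤m+n))
    cover (yes T≤m) = inj₁ ((T , s) ⊣ T≤m , bounded-≡ refl)
    cover (no  T≰m) = inj₂ ((T ∸ m , s) ⊣ m≤n+o⇒m∸n≤o T m T≤m+n ,
                            bounded-≡ (cong (_, s) (m∸n+n≡m (≰⇒≥ T≰m))))

  EdgeSplit : Bounded (m + n) → Bounded (m + n) → Set
  EdgeSplit r r′ =
      (Σ (Bounded m) λ p → Σ (Bounded m) λ p′ → LadderAdj p p′ × left p ≡ r × left p′ ≡ r′)
    ⊎ (Σ (Bounded n) λ q → Σ (Bounded n) λ q′ → LadderAdj q q′ × right q ≡ r × right q′ ≡ r′)

  glued-edge-split : ∀ {r r′} → LadderAdj r r′ → EdgeSplit r r′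
  glued-edge-split {u ⊣ _} {v ⊣ v≤m+n} e = split (block v ≤? m)
    where
    split : Dec (block v ≤ m) → EdgeSplit (u ⊣ _) (v ⊣ v≤m+n)
    split (yes v≤m) =
      inj₁ (u ⊣ ≤-trans (ladderEdge-block≤ e) v≤m , v ⊣ v≤m , e , bounded-≡ refl , bounded-≡ refl)
    split (no  v≰m) = inj₂ (unshift m u ⊣ m≤n+o⇒m∸n≤o _ m (≤-trans (ladderEdge-block≤ e) v≤m+n) ,
                            unshift m v ⊣ m≤n+o⇒m∸n≤o _ m v≤m+n ,
                            unshift-edge m≤u e ,
                            bounded-≡ (shift-unshift u m≤u) ,
                            bounded-≡ (shift-unshift v (≤-trans m≤u (ladderEdge-block≤ e))))
      where
      m≤u : m ≤ block u
      m≤u = s≤s⁻¹ (≤-trans (≰⇒> v≰m) (ladderEdge-block≤suc e))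

  via-left : ∀ {p r} → left p ≡ r → glued-map r ≡ map L₁ p
  via-left {p} refl = glued-left p

  via-right : ∀ {q r} → right q ≡ r → glued-map r ≡ map L₂ q
  via-right {q} refl = glued-right q

  glued-adjacent : ∀ {r r′} → LadderAdj r r′ → Adj G (glued-map r) (glued-map r′)
  glued-adjacent e with glued-edge-split e
  ... | inj₁ (p , p′ , e′ , p↦r , p′↦r′) =
    subst₂ (Adj G) (sym (via-left p↦r)) (sym (via-left p′↦r′)) (edges L₁ e′)
  ... | inj₂ (q , q′ , e′ , q↦r , q′↦r′) =
    subst₂ (Adj G) (sym (via-right {q} q↦r)) (sym (via-right {q′} q′↦r′)) (edges L₂ e′)

  crossing : ∀ p q → map L₁ p ≡ map L₂ q → left p ≡ right q
  crossing ((T , s) ⊣ T≤m) q p↦q with refl ← meet-at-junction ((T , s) ⊣ T≤m) q p↦q =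
    trans (bounded-≡ refl) (cong right (inj L₂ {(0 , s) ⊣ z≤n} {q}
      (trans (sym (junction s)) (trans (map-slot L₁ refl) p↦q))))

  glued-injective : ∀ {r r′} → glued-map r ≡ glued-map r′ → r ≡ r′
  glued-injective {r} {r′} eq with glued-cover r | glued-cover r′
  ... | inj₁ (p , p↦r) | inj₁ (p′ , p′↦r′) = trans (sym p↦r) (trans (cong left
          (inj L₁ (trans (sym (via-left p↦r)) (trans eq (via-left p′↦r′))))) p′↦r′)
  ... | inj₂ (q , q↦r) | inj₂ (q′ , q′↦r′) = trans (sym q↦r) (trans (cong right (inj L₂ {q} {q′}
          (trans (sym (via-right {q} q↦r)) (trans eq (via-right {q′} q′↦r′))))) q′↦r′)
  ... | inj₁ (p , p↦r) | inj₂ (q , q↦r′) = trans (sym p↦r) (trans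
          (crossing p q (trans (sym (via-left p↦r)) (trans eq (via-right {q} q↦r′)))) q↦r′)
  ... | inj₂ (q , q↦r) | inj₁ (p , p↦r′) = trans (sym q↦r) (trans
          (sym (crossing p q (trans (sym (via-left p↦r′)) (trans (sym eq) (via-right {q} q↦r))))) p↦r′)

  glued : Ladder G (m + n)
  glued = record { map = glued-map ; inj = glued-injective ; edges = glued-adjacent }

  glued-image : ∀ v → InImage glued-map v ⇔ (InImage (map L₁) v ⊎ InImage (map L₂) v)
  glued-image v = mk⇔
    (image-elim (λ v → InImage (map L₁) v ⊎ InImage (map L₂) v) λ r →
      Data.Sum.map (λ (p , p↦r) → p , sym (via-left p↦r))
                   (λ (q , q↦r) → q , sym (via-right {q} q↦r)) (glued-cover r))
    [ image-elim (InImage glued-map) (λ p → left p , glued-left p)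
    , image-elim (InImage glued-map) (λ q → right q , glued-right q)
    ]′

  glued-edgeImage : ∀ v w → EdgeImage LadderAdj glued-map v w ⇔
    (EdgeImage LadderAdj (map L₁) v w ⊎ EdgeImage LadderAdj (map L₂) v w)
  glued-edgeImage v w = mk⇔
    (edgeImage-elim _ (Data.Sum.map edgeImage-swap edgeImage-swap) split)
    [ edgeImage-elim _ edgeImage-swap (λ {p} {p′} e → subst₂ (EdgeImage LadderAdj glued-map)
        (glued-left p) (glued-left p′) (edgeImage-linked {p = left p} {left p′} (inj₁ e)))
    , edgeImage-elim _ edgeImage-swap (λ {q} {q′} e → subst₂ (EdgeImage LadderAdj glued-map)
        (glued-right q) (glued-right q′) (edgeImage-linked {p = right q} {right q′} (inj₁ (shift-edge e))))
    ]′
    where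
    split : ∀ {r r′} → LadderAdj r r′ →
      EdgeImage LadderAdj (map L₁) (glued-map r) (glued-map r′) ⊎
      EdgeImage LadderAdj (map L₂) (glued-map r) (glued-map r′)
    split e with glued-edge-split e
    ... | inj₁ (p , p′ , e′ , p↦r , p′↦r′) = inj₁ (subst₂ (EdgeImage LadderAdj (map L₁))
            (sym (via-left p↦r)) (sym (via-left p′↦r′)) (edgeImage-linked (inj₁ e′)))
    ... | inj₂ (q , q′ , e′ , q↦r , q′↦r′) = inj₂ (subst₂ (EdgeImage LadderAdj (map L₂))
            (sym (via-right {q} q↦r)) (sym (via-right {q′} q′↦r′)) (edgeImage-linked (inj₁ e′)))

-- The backbone-path as a ladder

isEven : ℕ → Bool
isEven zero          = true
isEven (suc zero)    = false
isEven (suc (suc n)) = isEven n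

isEven-double : ∀ t → isEven (t * 2) ≡ true
isEven-double zero    = refl
isEven-double (suc t) = isEven-double t

isEven-double+1 : ∀ t → isEven (suc (t * 2)) ≡ false
isEven-double+1 zero    = refl
isEven-double+1 (suc t) = isEven-double+1 t

odd≢even : ∀ a b → suc (a * 2) ≢ b * 2
odd≢even a b eq = even≢odd b a (trans (*-comm 2 b) (trans (sym eq) (cong suc (*-comm a 2))))

-- For even i the pairs w_i^a, w_i^b sit on blocks i − 1 and i, for odd i on blocks 2k − i + 1
-- and 2k − i, except that w_1^a sits on block 0.
aBlock : ℕ → ℕ → ℕ
aBlock k zero          = 0
aBlock k (suc zero)    = 0
aBlock k (suc (suc n)) = if isEven n then suc n else k * 2 ∸ suc n

bBlock : ℕ → ℕ → ℕ
bBlock k i = if isEven i then i else k * 2 ∸ i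

backboneSlot : ℕ → Lab → Slot
backboneSlot k (i , 1) = aBlock k i , true
backboneSlot k (i , 2) = aBlock k i , false
backboneSlot k (i , 3) = bBlock k i , false
backboneSlot k (i , _) = bBlock k i , true

aBlock-even : ∀ k t → aBlock k (suc t * 2) ≡ suc (t * 2)
aBlock-even k t rewrite isEven-double t = refl

aBlock-odd : ∀ k u → aBlock k (suc (suc u * 2)) ≡ k * 2 ∸ suc u * 2
aBlock-odd k u rewrite isEven-double+1 u = refl

bBlock-even : ∀ k t → bBlock k (t * 2) ≡ t * 2
bBlock-even k t rewrite isEven-double t = refl

bBlock-odd : ∀ k u → bBlock k (suc (u * 2)) ≡ k * 2 ∸ suc (u * 2)
bBlock-odd k u rewrite isEven-double+1 u = refl

data AIndex (k : ℕ) : ℕ → Set where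
  first : 1 ≤ k → AIndex k 1
  even  : ∀ t → suc t * 2 ≤ k → AIndex k (suc t * 2)
  odd   : ∀ u → suc (suc u * 2) ≤ k → AIndex k (suc (suc u * 2))

aIndex : ∀ {k i} → 1 ≤ i → i ≤ k → AIndex k i
aIndex {i = i} 1≤i i≤k with halve i
... | twice (suc t)       = even t i≤k
... | twice+1 zero        = first i≤k
... | twice+1 (suc u)     = odd u i≤k
aIndex () _ | twice zero

data BIndex (k : ℕ) : ℕ → Set where
  even : ∀ t → suc t * 2 ≤ k → BIndex k (suc t * 2)
  odd  : ∀ u → suc (u * 2) ≤ k → BIndex k (suc (u * 2))

bIndex : ∀ {k i} → AIndex k i → BIndex k i
bIndex (first 1≤k)  = odd 0 1≤k
bIndex (even t i≤k) = even t i≤k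
bIndex (odd u i≤k)  = odd (suc u) i≤k

n*2≡n+n : ∀ n → n * 2 ≡ n + n
n*2≡n+n n = trans (*-comm n 2) (cong (n +_) (+-identityʳ n))

n≤n*2 : ∀ n → n ≤ n * 2
n≤n*2 n = subst (n ≤_) (sym (n*2≡n+n n)) (m≤m+n n n)

*2∸-split : ∀ {k x} → x ≤ k → k * 2 ∸ x ≡ k + (k ∸ x)
*2∸-split {k} {x} x≤k = trans (cong (_∸ x) (n*2≡n+n k)) (+-∸-assoc k x≤k)

≤-*2∸ : ∀ {k x} → x ≤ k → k ≤ k * 2 ∸ x
≤-*2∸ {k} x≤k = subst (k ≤_) (sym (*2∸-split x≤k)) (m≤m+n k _)

<-*2∸ : ∀ {k x} → x < k → k < k * 2 ∸ x
<-*2∸ {k} {x} x<k = subst (k <_) (sym (*2∸-split (<⇒≤ x<k)))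
  (subst (_≤ k + (k ∸ x)) (+-comm k 1) (+-monoʳ-≤ k (m<n⇒0<n∸m x<k)))

*2∸-self : ∀ k → k * 2 ∸ k ≡ k
*2∸-self k = trans (*2∸-split {k} ≤-refl) (trans (cong (k +_) (n∸n≡0 k)) (+-identityʳ k))

*2∸-injective : ∀ {k x y} → x ≤ k → y ≤ k → k * 2 ∸ x ≡ k * 2 ∸ y → x ≡ y
*2∸-injective {k} x≤k y≤k = ∸-cancelˡ-≡ (≤-trans x≤k (n≤n*2 k)) (≤-trans y≤k (n≤n*2 k))

aBlock-injective : ∀ {k i i′} → AIndex k i → AIndex k i′ → aBlock k i ≡ aBlock k i′ → i ≡ i′
aBlock-injective (first _) (first _) _ = refl
aBlock-injective {k} (first _) (even t _) eq with () ← trans eq (aBlock-even k t)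
aBlock-injective {k} (first _) (odd u i≤k) eq =
  ⊥-elim (<⇒≢ (≤-<-trans z≤n (<-*2∸ i≤k)) (trans eq (aBlock-odd k u)))
aBlock-injective {k} (even t _) (first _) eq with () ← trans (sym (aBlock-even k t)) eq
aBlock-injective {k} (even t _) (even t′ _) eq = cong (λ x → suc x * 2) (*-cancelʳ-≡ t t′ 2
  (suc-injective (trans (sym (aBlock-even k t)) (trans eq (aBlock-even k t′)))))
aBlock-injective {k} (even t i≤k) (odd u i′≤k) eq = ⊥-elim (<⇒≢ (<-trans i≤k (<-*2∸ i′≤k))
  (trans (sym (aBlock-even k t)) (trans eq (aBlock-odd k u))))
aBlock-injective {k} (odd u i≤k) (first _) eq =
  ⊥-elim (<⇒≢ (≤-<-trans z≤n (<-*2∸ i≤k)) (sym (trans (sym (aBlock-odd k u)) eq)))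
aBlock-injective {k} (odd u i≤k) (even t i′≤k) eq = ⊥-elim (<⇒≢ (<-trans i′≤k (<-*2∸ i≤k))
  (sym (trans (sym (aBlock-odd k u)) (trans eq (aBlock-even k t)))))
aBlock-injective {k} (odd u i≤k) (odd u′ i′≤k) eq = cong suc (*2∸-injective (<⇒≤ i≤k) (<⇒≤ i′≤k)
  (trans (sym (aBlock-odd k u)) (trans eq (aBlock-odd k u′))))

bBlock-even≢odd : ∀ {k t u} → suc t * 2 ≤ k → suc (u * 2) ≤ k →
  bBlock k (suc t * 2) ≢ bBlock k (suc (u * 2))
bBlock-even≢odd {k} {t} {u} i≤k i′≤k eq = odd≢even u (suc t) (trans i′≡k (sym i≡k))
  where
  eq′ : suc t * 2 ≡ k * 2 ∸ suc (u * 2)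
  eq′ = trans (sym (bBlock-even k (suc t))) (trans eq (bBlock-odd k u))
  i≡k : suc t * 2 ≡ k
  i≡k = ≤-antisym i≤k (subst (k ≤_) (sym eq′) (≤-*2∸ i′≤k))
  i′≡k : suc (u * 2) ≡ k
  i′≡k = *2∸-injective i′≤k ≤-refl (trans (sym eq′) (trans i≡k (sym (*2∸-self k))))

bBlock-injective : ∀ {k i i′} → BIndex k i → BIndex k i′ → bBlock k i ≡ bBlock k i′ → i ≡ i′
bBlock-injective {k} (even t _) (even t′ _) eq =
  trans (sym (bBlock-even k (suc t))) (trans eq (bBlock-even k (suc t′)))
bBlock-injective {k} (odd u i≤k) (odd u′ i′≤k) eq =
  *2∸-injective i≤k i′≤k (trans (sym (bBlock-odd k u)) (trans eq (bBlock-odd k u′)))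
bBlock-injective (even t i≤k) (odd u i′≤k) eq = ⊥-elim (bBlock-even≢odd {t = t} {u} i≤k i′≤k eq)
bBlock-injective (odd u i≤k) (even t i′≤k) eq = ⊥-elim (bBlock-even≢odd {t = t} {u} i′≤k i≤k (sym eq))

aBlock≢bBlock : ∀ {k i i′} → AIndex k i → BIndex k i′ → aBlock k i ≢ bBlock k i′
aBlock≢bBlock {k} (first _) (even t′ _) eq with () ← trans eq (bBlock-even k (suc t′))
aBlock≢bBlock {k} (first 1≤k) (odd u′ i′≤k) eq =
  <⇒≢ (≤-trans 1≤k (≤-*2∸ i′≤k)) (trans eq (bBlock-odd k u′))
aBlock≢bBlock {k} (even t _) (even t′ _) eq =
  odd≢even t (suc t′) (trans (sym (aBlock-even k t)) (trans eq (bBlock-even k (suc t′))))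
aBlock≢bBlock {k} (even t i≤k) (odd u′ i′≤k) eq =
  <⇒≢ (<-≤-trans i≤k (≤-*2∸ i′≤k)) (trans (sym (aBlock-even k t)) (trans eq (bBlock-odd k u′)))
aBlock≢bBlock {k} (odd u i≤k) (even t′ i′≤k) eq =
  <⇒≢ (≤-<-trans i′≤k (<-*2∸ i≤k))
    (sym (trans (sym (aBlock-odd k u)) (trans eq (bBlock-even k (suc t′)))))
aBlock≢bBlock {k} (odd u i≤k) (odd u′ i′≤k) eq = odd≢even u′ (suc u)
  (sym (*2∸-injective (<⇒≤ i≤k) i′≤k (trans (sym (aBlock-odd k u)) (trans eq (bBlock-odd k u′)))))

vertexSlot : ∀ {k} → Fin k × Fin 4 → Slot
vertexSlot {k} v = backboneSlot k (BLab v)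

vertexSlot-injective : ∀ {k} (v w : Fin k × Fin 4) → vertexSlot v ≡ vertexSlot w → v ≡ w
vertexSlot-injective {k} (p , r) (p′ , r′) eq = go r r′ eq
  where
  a : AIndex k (lab p)
  a = aIndex (s≤s z≤n) (toℕ<n p)
  a′ : AIndex k (lab p′)
  a′ = aIndex (s≤s z≤n) (toℕ<n p′)
  same-index : ∀ {r} → lab p ≡ lab p′ → (p , r) ≡ (p′ , r)
  same-index eq = cong (_, _) (toℕ-injective (suc-injective eq))
  go : ∀ r r′ → vertexSlot (p , r) ≡ vertexSlot (p′ , r′) → (p , r) ≡ (p′ , r′)
  go 0F 0F eq = same-index (aBlock-injective a a′ (cong block eq))
  go 1F 1F eq = same-index (aBlock-injective a a′ (cong block eq))
  go 2F 2F eq = same-index (bBlock-injective (bIndex a) (bIndex a′) (cong block eq))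
  go 3F 3F eq = same-index (bBlock-injective (bIndex a) (bIndex a′) (cong block eq))
  go 0F 3F eq = ⊥-elim (aBlock≢bBlock a (bIndex a′) (cong block eq))
  go 3F 0F eq = ⊥-elim (aBlock≢bBlock a′ (bIndex a) (sym (cong block eq)))
  go 1F 2F eq = ⊥-elim (aBlock≢bBlock a (bIndex a′) (cong block eq))
  go 2F 1F eq = ⊥-elim (aBlock≢bBlock a′ (bIndex a) (sym (cong block eq)))
  go 0F 1F eq with () ← cong side eq
  go 0F 2F eq with () ← cong side eq
  go 1F 0F eq with () ← cong side eq
  go 1F 3F eq with () ← cong side eq
  go 2F 0F eq with () ← cong side eq
  go 2F 3F eq with () ← cong side eq
  go 3F 1F eq with () ← cong side eq
  go 3F 2F eq with () ← cong side eq

*2∸-< : ∀ {k x} → 1 ≤ x → x ≤ k * 2 → k * 2 ∸ x < k * 2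
*2∸-< 1≤x x≤k*2 = ∸-monoʳ-< 1≤x x≤k*2

aBlock-< : ∀ {k i} → AIndex k i → aBlock k i < k * 2
aBlock-< {k} (first 1≤k)  = ≤-trans 1≤k (n≤n*2 k)
aBlock-< {k} (even t i≤k) = subst (_< k * 2) (sym (aBlock-even k t)) (<-≤-trans i≤k (n≤n*2 k))
aBlock-< {k} (odd u i≤k)  = subst (_< k * 2) (sym (aBlock-odd k u))
  (*2∸-< {k} (s≤s z≤n) (≤-trans (<⇒≤ i≤k) (n≤n*2 k)))

bBlock-< : ∀ {k i} → BIndex k i → bBlock k i < k * 2
bBlock-< {suc k} (even t i≤k) = subst (_< suc k * 2) (sym (bBlock-even (suc k) (suc t)))
  (≤-<-trans i≤k (m<m*n (suc k) 2 (s≤s (s≤s z≤n))))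
bBlock-< {k} (odd u i≤k) = subst (_< k * 2) (sym (bBlock-odd k u))
  (*2∸-< {k} (s≤s z≤n) (≤-trans i≤k (n≤n*2 k)))

vertexSlot-< : ∀ {k} (v : Fin k × Fin 4) → block (vertexSlot v) < k * 2
vertexSlot-< (p , r) with aIndex (s≤s z≤n) (toℕ<n p)
... | a with r
...   | 0F = aBlock-< a
...   | 1F = aBlock-< a
...   | 2F = bBlock-< (bIndex a)
...   | 3F = bBlock-< (bIndex a)

data ConsecutiveFrom (T : ℕ) : ℕ → ℕ → Set where
  ascending  : ConsecutiveFrom T T (suc T)
  descending : ConsecutiveFrom T (suc T) T

Consecutive : ℕ → ℕ → Set
Consecutive A B = Σ ℕ λ T → ConsecutiveFrom T A B

Sq-map : ∀ {A B : Set} (f : A → B) {z₁ z₂ z₃ z₄ x y} →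
  Sq z₁ z₂ z₃ z₄ x y → Sq (f z₁) (f z₂) (f z₃) (f z₄) (f x) (f y)
Sq-map f s12 = s12
Sq-map f s23 = s23
Sq-map f s34 = s34
Sq-map f s13 = s13
Sq-map f s24 = s24

ladderSquare : ∀ {T A B u v} → ConsecutiveFrom T A B →
  Sq (A , true) (A , false) (B , false) (B , true) u v → Linked LadderEdge u v
ladderSquare {T} ascending  s12 = inj₂ (inner T)
ladderSquare {T} ascending  s23 = inj₁ (lower T false)
ladderSquare {T} ascending  s34 = inj₁ (inner (suc T))
ladderSquare {T} ascending  s13 = inj₁ (upper T)
ladderSquare {T} ascending  s24 = inj₁ (lower T true)
ladderSquare {T} descending s12 = inj₂ (inner (suc T))
ladderSquare {T} descending s23 = inj₂ (lower T false)
ladderSquare {T} descending s34 = inj₁ (inner T)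
ladderSquare {T} descending s13 = inj₂ (lower T true)
ladderSquare {T} descending s24 = inj₂ (upper T)

consecutive-∸ : ∀ {x n} → suc x ≤ n → Consecutive (n ∸ x) (n ∸ suc x)
consecutive-∸ {x} {n} x<n = subst (λ y → Consecutive y (n ∸ suc x)) (sym (+-∸-assoc 1 x<n))
  (n ∸ suc x , descending)

rung-consecutive : ∀ {k i} → 2 ≤ i → i ≤ k → Consecutive (aBlock k i) (bBlock k i)
rung-consecutive {k} 2≤i i≤k with aIndex (≤-trans (s≤s z≤n) 2≤i) i≤k
... | first _ with s≤s () ← 2≤i
... | even t _ rewrite aBlock-even k t | bBlock-even k (suc t) = suc (t * 2) , ascending
... | odd u _ rewrite aBlock-odd k u | bBlock-odd k (suc u) = consecutive-∸ (≤-trans i≤k (n≤n*2 k))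

m≤n∸2⇒2+m≤n : ∀ {i k} → 1 ≤ i → i ≤ k ∸ 2 → suc (suc i) ≤ k
m≤n∸2⇒2+m≤n {k = zero}        1≤i i≤0 = ⊥-elim (<⇒≱ 1≤i i≤0)
m≤n∸2⇒2+m≤n {k = suc zero}    1≤i i≤0 = ⊥-elim (<⇒≱ 1≤i i≤0)
m≤n∸2⇒2+m≤n {k = suc (suc k)} _   i≤k = s≤s (s≤s i≤k)

link-consecutive : ∀ {k i} → 1 ≤ i → suc (suc i) ≤ k → Consecutive (bBlock k i) (aBlock k (i + 2))
link-consecutive {k} {i} 1≤i i+2≤k rewrite +-comm i 2
  with aIndex 1≤i (≤-trans (n≤1+n i) (≤-trans (n≤1+n _) i+2≤k))
... | first _  = consecutive-∸ (≤-trans (≤-trans (n≤1+n _) i+2≤k) (n≤n*2 k))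
... | even t _ rewrite aBlock-even k (suc t) | bBlock-even k (suc t) = suc t * 2 , ascending
... | odd u _  rewrite aBlock-odd k (suc u) | bBlock-odd k (suc u) =
  consecutive-∸ (≤-trans (≤-trans (n≤1+n _) i+2≤k) (n≤n*2 k))

bBlock-top : ∀ t → bBlock (suc (t * 2)) (suc (t * 2)) ≡ suc (t * 2)
bBlock-top t = trans (bBlock-odd (suc (t * 2)) t) (*2∸-self (suc (t * 2)))

bBlock-below-top : ∀ t → bBlock (suc t * 2) (suc (t * 2)) ≡ suc (suc t * 2)
bBlock-below-top t = trans (bBlock-odd k t) (trans (+-∸-assoc 1 (n≤n*2 k)) (cong suc (*2∸-self k)))
  where k = suc t * 2

finish-consecutive : ∀ {k} → 2 ≤ k → Consecutive (bBlock k (k ∸ 1)) (bBlock k k)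
finish-consecutive {k} 2≤k with halve k
... | twice zero with () ← 2≤k
... | twice+1 zero with s≤s () ← 2≤k
... | twice (suc t) =
  subst₂ Consecutive (sym (bBlock-below-top t)) (sym (bBlock-even k (suc t))) (k , descending)
... | twice+1 (suc t) =
  subst₂ Consecutive (sym (bBlock-even k (suc t))) (sym (bBlock-top (suc t))) (suc t * 2 , ascending)

backboneEdge⇒ladderEdge : ∀ {k x y} → BLabEdge k x y →
  Linked LadderEdge (backboneSlot k x) (backboneSlot k y)
backboneEdge⇒ladderEdge firstA = inj₂ (inner 0)
backboneEdge⇒ladderEdge firstB = inj₁ (inner _)
backboneEdge⇒ladderEdge {k} (rung 2≤i i≤k sq) =
  ladderSquare (proj₂ (rung-consecutive 2≤i i≤k)) (Sq-map (backboneSlot k) sq)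
backboneEdge⇒ladderEdge {k} (start _ sq) = ladderSquare ascending (Sq-map (backboneSlot k) sq)
backboneEdge⇒ladderEdge {k} (link 1≤i i≤k∸2 sq) =
  ladderSquare (proj₂ (link-consecutive 1≤i (m≤n∸2⇒2+m≤n 1≤i i≤k∸2))) (Sq-map (backboneSlot k) sq)
backboneEdge⇒ladderEdge {k} (finish 2≤k sq) =
  ladderSquare (proj₂ (finish-consecutive 2≤k)) (Sq-map (backboneSlot k) sq)

IsLabel : ℕ → Lab → Set
IsLabel k x = Σ (Fin k × Fin 4) λ v → BLab v ≡ x

isLabel : ∀ {k i} → 1 ≤ i → i ≤ k → (r : Fin 4) → IsLabel k (i , lab r)
isLabel {i = suc i} _ i<k r = (fromℕ< i<k , r) , cong (λ n → suc n , lab r) (toℕ-fromℕ< i<k)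

Sq-corners : ∀ {A : Set} (P : A → Set) {z₁ z₂ z₃ z₄ x y} → P z₁ → P z₂ → P z₃ → P z₄ →
  Sq z₁ z₂ z₃ z₄ x y → P x × P y
Sq-corners P p₁ p₂ p₃ p₄ s12 = p₁ , p₂
Sq-corners P p₁ p₂ p₃ p₄ s23 = p₂ , p₃
Sq-corners P p₁ p₂ p₃ p₄ s34 = p₃ , p₄
Sq-corners P p₁ p₂ p₃ p₄ s13 = p₁ , p₃
Sq-corners P p₁ p₂ p₃ p₄ s24 = p₂ , p₄

square-labels : ∀ {k i i′ x y} (r₁ r₂ r₃ r₄ : Fin 4) → 1 ≤ i → i ≤ k → 1 ≤ i′ → i′ ≤ k →
  Sq (i , lab r₁) (i , lab r₂) (i′ , lab r₃) (i′ , lab r₄) x y → IsLabel k x × IsLabel k y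
square-labels r₁ r₂ r₃ r₄ 1≤i i≤k 1≤i′ i′≤k = Sq-corners (IsLabel _)
  (isLabel 1≤i i≤k r₁) (isLabel 1≤i i≤k r₂) (isLabel 1≤i′ i′≤k r₃) (isLabel 1≤i′ i′≤k r₄)

backboneEdge-labels : ∀ {k x y} → 1 ≤ k → BLabEdge k x y → IsLabel k x × IsLabel k y
backboneEdge-labels 1≤k firstA = isLabel ≤-refl 1≤k 0F , isLabel ≤-refl 1≤k 1F
backboneEdge-labels 1≤k firstB = isLabel ≤-refl 1≤k 2F , isLabel ≤-refl 1≤k 3F
backboneEdge-labels _ (rung 2≤i i≤k sq) =
  square-labels 0F 1F 2F 3F (≤-trans (n≤1+n 1) 2≤i) i≤k (≤-trans (n≤1+n 1) 2≤i) i≤k sq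
backboneEdge-labels 1≤k (start 2≤k sq) = square-labels 0F 1F 1F 0F ≤-refl 1≤k (n≤1+n 1) 2≤k sq
backboneEdge-labels {k} _ (link {i} 1≤i i≤k∸2 sq) =
  square-labels 3F 2F 1F 0F 1≤i (≤-trans (n≤1+n i) (≤-trans (n≤1+n _) i+2≤k))
    (≤-trans 1≤i (m≤m+n i 2)) (subst (_≤ k) (+-comm 2 i) i+2≤k) sq
  where
  i+2≤k : suc (suc i) ≤ k
  i+2≤k = m≤n∸2⇒2+m≤n 1≤i i≤k∸2
backboneEdge-labels {suc k} _ (finish 2≤k sq) =
  square-labels 3F 2F 2F 3F (s≤s⁻¹ 2≤k) (n≤1+n k) (s≤s z≤n) ≤-refl sq

backboneEdge-vertices : ∀ {k x y} → 1 ≤ k → BLabEdge k x y →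
  Σ (Fin k × Fin 4) λ v → Σ (Fin k × Fin 4) λ w → BEdge k v w × BLab v ≡ x × BLab w ≡ y
backboneEdge-vertices 1≤k e with backboneEdge-labels 1≤k e
... | (v , refl) , (w , refl) = v , w , e , refl , refl

Sq-reverse : ∀ {A : Set} {z₁ z₂ z₃ z₄ x y : A} → Sq z₄ z₃ z₂ z₁ x y → Sq z₁ z₂ z₃ z₄ y x
Sq-reverse s12 = s34
Sq-reverse s23 = s23
Sq-reverse s34 = s12
Sq-reverse s13 = s24
Sq-reverse s24 = s13

Sq-preimage : ∀ {A B : Set} (f : A → B) {z₁ z₂ z₃ z₄ w₁ w₂ w₃ w₄ u v} →
  f z₁ ≡ w₁ → f z₂ ≡ w₂ → f z₃ ≡ w₃ → f z₄ ≡ w₄ → Sq w₁ w₂ w₃ w₄ u v →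
  Σ A λ x → Σ A λ y → Sq z₁ z₂ z₃ z₄ x y × f x ≡ u × f y ≡ v
Sq-preimage f e₁ e₂ e₃ e₄ s12 = _ , _ , s12 , e₁ , e₂
Sq-preimage f e₁ e₂ e₃ e₄ s23 = _ , _ , s23 , e₂ , e₃
Sq-preimage f e₁ e₂ e₃ e₄ s34 = _ , _ , s34 , e₃ , e₄
Sq-preimage f e₁ e₂ e₃ e₄ s13 = _ , _ , s13 , e₁ , e₃
Sq-preimage f e₁ e₂ e₃ e₄ s24 = _ , _ , s24 , e₂ , e₄

record CoveringSquare (k T : ℕ) : Set where
  field
    q₁ q₂ q₃ q₄ : Lab
    A B         : ℕ
    blocks      : ConsecutiveFrom T A B
    slot₁       : backboneSlot k q₁ ≡ (A , true)
    slot₂       : backboneSlot k q₂ ≡ (A , false)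
    slot₃       : backboneSlot k q₃ ≡ (B , false)
    slot₄       : backboneSlot k q₄ ≡ (B , true)
    edge        : ∀ {x y} → Sq q₁ q₂ q₃ q₄ x y → BLabEdge k x y

BackbonePreimage : ℕ → Slot → Slot → Set
BackbonePreimage k u v = Σ Lab λ x → Σ Lab λ y →
  backboneSlot k x ≡ u × backboneSlot k y ≡ v × Linked (BLabEdge k) x y

coveringSquare-preimage : ∀ {k T u v} → CoveringSquare k T →
  Sq (T , true) (T , false) (suc T , false) (suc T , true) u v → BackbonePreimage k u v
coveringSquare-preimage {k} C sq with CoveringSquare.blocks C
... | ascending with Sq-preimage (backboneSlot k) slot₁ slot₂ slot₃ slot₄ sq
  where open CoveringSquare C
...   | x , y , sq′ , x↦u , y↦v = x , y , x↦u , y↦v , inj₁ (CoveringSquare.edge C sq′)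
coveringSquare-preimage {k} C sq | descending
  with Sq-preimage (backboneSlot k) slot₄ slot₃ slot₂ slot₁ sq
  where open CoveringSquare C
...   | x , y , sq′ , x↦u , y↦v = x , y , x↦u , y↦v , inj₂ (CoveringSquare.edge C (Sq-reverse sq′))

∸-solve : ∀ x {T n} → x + T ≡ n → n ∸ x ≡ T
∸-solve x {T} refl = m+n∸m≡n x T

excess : ∀ {t k} → suc (suc (suc (t * 2))) ≤ k * 2 → Σ ℕ λ u → k ≡ suc (suc t) + u
excess {t} {suc m} h with m≤n⇒∃[o]m+o≡n {suc t} {m} (block-≤ (suc t , false) h)
... | u , refl = u , refl

excess<t : ∀ t u → suc (suc t) + u < suc t * 2 → u < t
excess<t t u h = +-cancelˡ-≤ t (suc u) t
  (subst₂ _≤_ (sym (+-suc t u)) (n*2≡n+n t) (s≤s⁻¹ (s≤s⁻¹ h)))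

double+1≤ : ∀ {t u} → u < t → suc (u * 2) ≤ t + u
double+1≤ {t} {u} u<t = subst (_≤ t + u) (cong suc (sym (n*2≡n+n u))) (+-monoˡ-≤ u u<t)

odd-rung-a : ∀ t u → suc u * 2 + suc (suc (t * 2)) ≡ (suc (suc t) + u) * 2
odd-rung-a = solve-∀

odd-rung-b : ∀ t u → suc (suc u * 2) + suc (t * 2) ≡ (suc (suc t) + u) * 2
odd-rung-b = solve-∀

odd-link-b : ∀ t u → suc (u * 2) + suc (suc t * 2) ≡ (suc (suc t) + u) * 2
odd-link-b = solve-∀

odd-link-a : ∀ t u → suc u * 2 + suc t * 2 ≡ (suc (suc t) + u) * 2
odd-link-a = solve-∀

ascendingAt : ∀ {T A B} → A ≡ T → B ≡ suc T → ConsecutiveFrom T A B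
ascendingAt refl refl = ascending

descendingAt : ∀ {T A B} → A ≡ suc T → B ≡ T → ConsecutiveFrom T A B
descendingAt refl refl = descending

startSquare : ∀ {k} → 2 ≤ k → CoveringSquare k 0
startSquare 2≤k = record
  { q₁ = 1 , 1 ; q₂ = 1 , 2 ; q₃ = 2 , 2 ; q₄ = 2 , 1 ; A = 0 ; B = 1 ; blocks = ascending
  ; slot₁ = refl ; slot₂ = refl ; slot₃ = refl ; slot₄ = refl ; edge = start 2≤k }

rungSquare : ∀ {k T i} → 2 ≤ i → i ≤ k → ConsecutiveFrom T (aBlock k i) (bBlock k i) → CoveringSquare k T
rungSquare {i = i} 2≤i i≤k blocks = record
  { q₁ = i , 1 ; q₂ = i , 2 ; q₃ = i , 3 ; q₄ = i , 4 ; A = _ ; B = _ ; blocks = blocks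
  ; slot₁ = refl ; slot₂ = refl ; slot₃ = refl ; slot₄ = refl ; edge = rung 2≤i i≤k }

linkSquare : ∀ {k T i} → 1 ≤ i → i ≤ k ∸ 2 → ConsecutiveFrom T (bBlock k i) (aBlock k (i + 2)) →
  CoveringSquare k T
linkSquare {i = i} 1≤i i≤k∸2 blocks = record
  { q₁ = i , 4 ; q₂ = i , 3 ; q₃ = i + 2 , 2 ; q₄ = i + 2 , 1 ; A = _ ; B = _ ; blocks = blocks
  ; slot₁ = refl ; slot₂ = refl ; slot₃ = refl ; slot₄ = refl ; edge = link 1≤i i≤k∸2 }

finishSquare : ∀ {k T} → 2 ≤ k → ConsecutiveFrom T (bBlock k (k ∸ 1)) (bBlock k k) → CoveringSquare k T
finishSquare {k} 2≤k blocks = record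
  { q₁ = k ∸ 1 , 4 ; q₂ = k ∸ 1 , 3 ; q₃ = k , 3 ; q₄ = k , 4 ; A = _ ; B = _ ; blocks = blocks
  ; slot₁ = refl ; slot₂ = refl ; slot₃ = refl ; slot₄ = refl ; edge = finish 2≤k }

-- For odd T the blocks T, T + 1 lie under rung T + 1 on the way up or under rung 2k − T on the way
-- down; for even T under the link at T, the finish square, or the link at 2k − T − 1.
coveringSquare : ∀ {k T} → 2 ≤ k → suc T < k * 2 → CoveringSquare k T
coveringSquare {k} {T} 2≤k T+1<k*2 with halve T
... | twice zero = startSquare 2≤k
... | twice+1 t with suc t * 2 ≤? k
...   | yes i≤k = rungSquare (s≤s (s≤s z≤n)) i≤k
        (ascendingAt (aBlock-even k t) (bBlock-even k (suc t)))
...   | no i≰k with excess {t} {k} T+1<k*2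
...     | u , refl = rungSquare (s≤s (s≤s z≤n)) (s≤s (s≤s (double+1≤ (excess<t t u (≰⇒> i≰k)))))
          (descendingAt (trans (aBlock-odd k u) (∸-solve (suc u * 2) (odd-rung-a t u)))
                        (trans (bBlock-odd k (suc u)) (∸-solve (suc (suc u * 2)) (odd-rung-b t u))))
coveringSquare {k} {T} 2≤k T+1<k*2 | twice (suc t) with <-cmp (suc T) k
... | tri< T+1<k _ _ = linkSquare (s≤s z≤n) (∸-monoˡ-≤ 2 T+1<k)
        (ascendingAt (bBlock-even k (suc t)) (trans (cong (aBlock k) (+-comm T 2)) (aBlock-even k (suc t))))
... | tri≈ _ refl _ = finishSquare 2≤k (ascendingAt (bBlock-even k (suc t)) (bBlock-top (suc t)))
... | tri> _ _ k<T+1 with m≤n⇒m<n∨m≡n (s≤s⁻¹ k<T+1)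
...   | inj₂ refl = finishSquare 2≤k (descendingAt (bBlock-below-top t) (bBlock-even k (suc t)))
...   | inj₁ k<T with excess {t} {k} (≤-trans (n≤1+n _) T+1<k*2)
...     | u , refl = linkSquare (s≤s z≤n) (double+1≤ (excess<t t u k<T))
          (descendingAt (trans (bBlock-odd k u) (∸-solve (suc (u * 2)) (odd-link-b t u)))
            (trans (cong (aBlock k) (+-comm (suc (u * 2)) 2))
                   (trans (aBlock-odd k u) (∸-solve (suc u * 2) (odd-link-a t u)))))

preimage-swap : ∀ {k u v} → BackbonePreimage k u v → BackbonePreimage k v u
preimage-swap (x , y , x↦u , y↦v , e) = y , x , y↦v , x↦u , Data.Sum.swap e

ladderEdge-preimage : ∀ {k u v} → 2 ≤ k → LadderEdge u v → block v < k * 2 → BackbonePreimage k u v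
ladderEdge-preimage 2≤k (inner zero) _ =
  preimage-swap (coveringSquare-preimage (coveringSquare 2≤k (≤-trans 2≤k (n≤n*2 _))) s12)
ladderEdge-preimage 2≤k (inner (suc T)) T<k*2 = coveringSquare-preimage (coveringSquare 2≤k T<k*2) s34
ladderEdge-preimage 2≤k (lower T false) T<k*2 = coveringSquare-preimage (coveringSquare 2≤k T<k*2) s23
ladderEdge-preimage 2≤k (lower T true) T<k*2 = coveringSquare-preimage (coveringSquare 2≤k T<k*2) s24
ladderEdge-preimage 2≤k (upper T) T<k*2 = coveringSquare-preimage (coveringSquare 2≤k T<k*2) s13

preimage-vertices : ∀ {k u v} → 1 ≤ k → BackbonePreimage k u v →
  Σ (Fin k × Fin 4) λ v′ → Σ (Fin k × Fin 4) λ w′ →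
    vertexSlot v′ ≡ u × vertexSlot w′ ≡ v × Linked (BEdge k) v′ w′
preimage-vertices 1≤k (x , y , x↦u , y↦v , inj₁ e) with backboneEdge-vertices 1≤k e
... | v′ , w′ , e′ , refl , refl = v′ , w′ , x↦u , y↦v , inj₁ e′
preimage-vertices 1≤k (x , y , x↦u , y↦v , inj₂ e) with backboneEdge-vertices 1≤k e
... | w′ , v′ , e′ , refl , refl = v′ , w′ , x↦u , y↦v , inj₂ e′

module _ {k N : ℕ} (2≤k : 2 ≤ k) (k*2≡N+1 : k * 2 ≡ suc N) where

  private
    1≤k : 1 ≤ k
    1≤k = ≤-trans (n≤1+n 1) 2≤k

    <k*2⇒≤N : ∀ {T} → T < k * 2 → T ≤ N
    <k*2⇒≤N {T} T<k*2 = s≤s⁻¹ (subst (T <_) k*2≡N+1 T<k*2)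

    ≤N⇒<k*2 : ∀ {T} → T ≤ N → T < k * 2
    ≤N⇒<k*2 {T} T≤N = subst (T <_) (sym k*2≡N+1) (s≤s T≤N)

  backboneVertex : Fin k × Fin 4 → Bounded N
  backboneVertex v = vertexSlot v ⊣ <k*2⇒≤N (vertexSlot-< v)

  backbone≅ladder : Isomorphism (BEdge k) (LadderAdj {N})
  backbone≅ladder = record
    { to         = backboneVertex
    ; injective  = λ {v} {w} eq → vertexSlot-injective v w (cong slot eq)
    ; surjective = surjective
    ; edge       = backboneEdge⇒ladderEdge
    ; edge⁻¹     = edge⁻¹
    }
    where
    surjective : ∀ p → Σ (Fin k × Fin 4) λ v → backboneVertex v ≡ p
    surjective ((T , s) ⊣ T≤N)
      with preimage-vertices 1≤k (ladderEdge-preimage 2≤k (inner T) (≤N⇒<k*2 T≤N))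
    ... | v , w , v↦ , w↦ , _ with s
    ...   | false = v , bounded-≡ v↦
    ...   | true  = w , bounded-≡ w↦

    edge⁻¹ : ∀ {v w} → LadderAdj (backboneVertex v) (backboneVertex w) → Linked (BEdge k) v w
    edge⁻¹ {v} {w} e with preimage-vertices 1≤k (ladderEdge-preimage 2≤k e (vertexSlot-< w))
    ... | v′ , w′ , v′↦v , w′↦w , linked =
      subst₂ (Linked (BEdge k)) (vertexSlot-injective v′ v v′↦v) (vertexSlot-injective w′ w w′↦w) linked

module BackboneOfPseudoPaths
  {G : Graph} {a b c : Pair (V G)} {m n k : ℕ} (2≤k : 2 ≤ k) (k*2≡m+n+1 : k * 2 ≡ suc (m + n))
  (P : PseudoPath G (suc m * 2) a b) (Q : PseudoPath G (suc n * 2) (rev c) b)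
  (disjoint : InternallyDisjoint b P Q) where

  module LP = PathLadder {m = m} P
  module LQ = PathLadder {m = n} Q

  L₁ : Ladder G m
  L₁ = LP.ladder

  L₂ : Ladder G n
  L₂ = reverse LQ.ladder

  junction : ∀ s → map L₁ ((m , s) ⊣ ≤-refl) ≡ map L₂ ((0 , s) ⊣ z≤n)
  junction false = trans (LP.end₁ {≤-refl}) (sym (LQ.end₁ {m∸n≤m n 0}))
  junction true  = trans (LP.end₂ {≤-refl}) (sym (LQ.end₂ {m∸n≤m n 0}))

  meet-at-junction : ∀ p q → map L₁ p ≡ map L₂ q → block (slot p) ≡ m
  meet-at-junction p q p↦q = LP.end⁻¹ p (disjoint (pathVertex p) (pathVertex (mirror q)) p↦q)

  open Glue L₁ L₂ junction meet-at-junction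
    using (left; right; glued; glued-left; glued-right; glued-image; glued-edgeImage)

  backbone≅glued : Isomorphism (BEdge k) (LadderAdj {m + n})
  backbone≅glued = backbone≅ladder 2≤k k*2≡m+n+1

  backboneEmbedding : Embedding (Fin k × Fin 4) (BEdge k) G
  backboneEmbedding = precompose backbone≅glued glued

  at-label : ∀ v {x} → BLab v ≡ x → (p : Bounded (m + n)) → backboneSlot k x ≡ slot p →
    map backboneEmbedding v ≡ map glued p
  at-label v v↦x p x↦p = map-slot glued (trans (cong (backboneSlot k) v↦x) x↦p)

  last-block : bBlock k 1 ≡ n + m
  last-block = trans (cong (_∸ 1) k*2≡m+n+1) (+-comm m n)

  start-of-Q : ∀ s → map glued (right ((n , s) ⊣ ≤-refl)) ≡ map LQ.ladder ((0 , s) ⊣ z≤n)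
  start-of-Q s = trans (glued-right ((n , s) ⊣ ≤-refl))
    (map-slot LQ.ladder {mirror ((n , s) ⊣ ≤-refl)} {(0 , s) ⊣ z≤n} (cong (_, s) (n∸n≡0 n)))

  backbone : BackbonePath G k a c
  backbone = record
    { emb   = backboneEmbedding
    ; one≤k = ≤-trans (n≤1+n 1) 2≤k
    ; a₁    = λ v v↦ → trans (at-label v v↦ (left ((0 , false) ⊣ z≤n)) refl)
                             (trans (glued-left ((0 , false) ⊣ z≤n)) (LP.start₁ {z≤n}))
    ; a₂    = λ v v↦ → trans (at-label v v↦ (left ((0 , true) ⊣ z≤n)) refl)
                             (trans (glued-left ((0 , true) ⊣ z≤n)) (LP.start₂ {z≤n}))
    ; c₁    = λ v v↦ → trans (at-label v v↦ (right ((n , true) ⊣ ≤-refl)) (cong (_, true) last-block))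
                             (trans (start-of-Q true) (LQ.start₂ {z≤n}))
    ; c₂    = λ v v↦ → trans (at-label v v↦ (right ((n , false) ⊣ ≤-refl)) (cong (_, false) last-block))
                             (trans (start-of-Q false) (LQ.start₁ {z≤n}))
    }

  backbone-union : UnionIs P Q backbone
  backbone-union = (λ v → pair (vertexSets v)) , (λ v w → pair (edgeSets v w))
    where
    pair : ∀ {A B : Set} → A ⇔ B → (A → B) × (B → A)
    pair e = Equivalence.to e , Equivalence.from e

    vertexSets : ∀ v → InImage (map backboneEmbedding) v ⇔
      (InImage (map (emb P)) v ⊎ InImage (map (emb Q)) v)
    vertexSets v = ⇔-trans (image-precompose backbone≅glued (map glued) v)
      (⇔-trans (glued-image v)
      (image-precompose (ladder≅pseudoPath {m}) (map (emb P)) v ⊎-⇔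
        ⇔-trans (image-precompose (ladder≅mirror {n}) (map LQ.ladder) v)
                (image-precompose (ladder≅pseudoPath {n}) (map (emb Q)) v)))

    edgeSets : ∀ v w → EdgeImage (BEdge k) (map backboneEmbedding) v w ⇔
      (EdgeImage (SEdge (suc m * 2)) (map (emb P)) v w ⊎
       EdgeImage (SEdge (suc n * 2)) (map (emb Q)) v w)
    edgeSets v w = ⇔-trans (edgeImage-precompose backbone≅glued (map glued) v w)
      (⇔-trans (glued-edgeImage v w)
      (edgeImage-precompose (ladder≅pseudoPath {m}) (map (emb P)) v w ⊎-⇔
        ⇔-trans (edgeImage-precompose (ladder≅mirror {n}) (map LQ.ladder) v w)
                (edgeImage-precompose (ladder≅pseudoPath {n}) (map (emb Q)) v w)))

pseudoPath-lengths : ∀ ℓ₁ ℓ₂ → 4 ∣ ℓ₁ → 4 ∣ ℓ₁ + ℓ₂ ∸ 2 → 2 ≤ ℓ₁ → 2 ≤ ℓ₂ →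
  Σ ℕ λ q → Σ ℕ λ w → ℓ₁ ≡ suc (suc (q * 2)) * 2 × ℓ₂ ≡ suc (w * 2) * 2
pseudoPath-lengths .(q * 4) ℓ₂ 4∣ℓ₁@(divides q refl) 4∣ℓ₁+ℓ₂∸2 2≤ℓ₁ 2≤ℓ₂
  with m≤n⇒∃[o]m+o≡n 2≤ℓ₂
... | d , refl
  with ∣m+n∣m⇒∣n (subst (4 ∣_) (+-∸-assoc (q * 4) {2 + d} (s≤s (s≤s z≤n))) 4∣ℓ₁+ℓ₂∸2) 4∣ℓ₁
...   | divides w refl with q
...     | zero with () ← 2≤ℓ₁
...     | suc q′ = q′ , w , four-fold q′ , two-mod-four w
  where
  four-fold : ∀ q → suc q * 4 ≡ suc (suc (q * 2)) * 2
  four-fold = solve-∀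
  two-mod-four : ∀ w → 2 + w * 4 ≡ suc (w * 2) * 2
  two-mod-four = solve-∀

backbone-blocks : ∀ q w → (suc q + suc w) * 2 ≡ suc (suc (q * 2) + suc w * 2)
backbone-blocks = solve-∀

proposition4p2 : (G : Graph) (a b c : Pair (V G)) (ℓ₁ ℓ₂ : ℕ) →
    InV² a → InV² b → InV² c →
    DisjointPairs a b → DisjointPairs a c → DisjointPairs b c →
    4 ∣ ℓ₁ → 4 ∣ (ℓ₁ + ℓ₂ ∸ 2) →
    (P : PseudoPath G ℓ₁ a b) → (Q : PseudoPath G ℓ₂ (rev c) b) →
    InternallyDisjoint b P Q →
    Σ ℕ λ k → Σ (BackbonePath G k a c) λ B → UnionIs P Q B
proposition4p2 G a b c ℓ₁ ℓ₂ _ _ _ _ _ b#c 4∣ℓ₁ 4∣ℓ₁+ℓ₂∸2 P Q disjoint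
  with pseudoPath-lengths ℓ₁ ℓ₂ 4∣ℓ₁ 4∣ℓ₁+ℓ₂∸2 (two≤ℓ P) (two≤ℓ Q)
-- A (2,2)-pseudo-path from rev c to b would force b₁ = c₂.
... | q , zero , refl , refl =
  ⊥-elim (proj₁ (proj₂ b#c) (trans (sym (tgt₁ Q 0F refl)) (src₁ Q 0F refl)))
... | q , suc w , refl , refl = suc q + suc w , backbone , backbone-union
  where
  2≤k : 2 ≤ suc q + suc w
  2≤k = s≤s (≤-trans (s≤s z≤n) (m≤n+m (suc w) q))
  open BackboneOfPseudoPaths 2≤k (backbone-blocks q w) P Q disjoint
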